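{- Every graph $G$ with $n\geq 3$ vertices and no $K_5$-minor has at most $8(n-2)$ cliques.
   Context: All graphs are finite, simple and undirected. A graph $H$ is a minor of $G$ if $H$ can be obtained from a subgraph of $G$ by contracting edges. A clique is a (possibly empty) set of pairwise adjacent vertices; the number of cliques counts $\emptyset$ and single vertices. -}

module Defs where

open import Data.Bool using (Bool; true; false; _∧_; _∨_; not; if_then_else_)
open import Data.Nat using (ℕ; zero; suc)
open import Data.Fin using (Fin; _≟_)
open import Data.Fin.Subset using (Subset; _∈_)
open import Data.Vec using (Vec; []; _∷_; lookup)
open import Data.List using (List; []; _∷_; map; _++_; length; filterᵇ)
open import Data.List.Base using (allFin)
open import Data.Bool.ListAction using (all)
open import Data.Vec.Base using (toList)
open import Data.Maybe using (Maybe; just)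
open import Data.Product using (Σ; ∃; _×_)
open import Relation.Binary.PropositionalEquality using (_≡_; _≢_)
open import Relation.Nullary.Decidable using (⌊_⌋)

record Graph (n : ℕ) : Set where
  field
    adj    : Fin n → Fin n → Bool
    sym    : ∀ u v → adj u v ≡ adj v u
    irrefl : ∀ v → adj v v ≡ false

open Graph public

Adj : ∀ {n} → Graph n → Fin n → Fin n → Set
Adj G u v = adj G u v ≡ true

allSubsets : (n : ℕ) → List (Subset n)
allSubsets zero = [] ∷ []
allSubsets (suc n) = map (true ∷_) (allSubsets n) ++ map (false ∷_) (allSubsets n)

isCliqueᵇ : ∀ {n} → Graph n → Subset n → Bool
isCliqueᵇ {n} G S =
  all (λ u → all (λ v →
         not (lookup S u ∧ lookup S v) ∨ ⌊ u ≟ v ⌋ ∨ adj G u v)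
       (allFin n))
    (allFin n)

-- Number of cliques of G (including ∅ and single vertices).
numCliques : ∀ {n} → Graph n → ℕ
numCliques {n} G = length (filterᵇ (isCliqueᵇ G) (allSubsets n))

data WalkIn {n} (G : Graph n) (P : Fin n → Set) : Fin n → Fin n → Set where
  here : ∀ {u} → P u → WalkIn G P u u
  step : ∀ {u w v} → P u → Adj G u w → WalkIn G P w v → WalkIn G P u v

-- A model of K_m in G (G contains K_m as a minor): an assignment of
-- vertices to at most one of m branch sets (so branch sets are pairwise
-- disjoint), each branch set nonempty and inducing a connected subgraph,
-- and any two distinct branch sets joined by an edge of G.
record KMinorModel {n} (m : ℕ) (G : Graph n) : Set where
  field
    branch    : Fin n → Maybe (Fin m)
    nonempty  : ∀ i → ∃ λ v → branch v ≡ just i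
    connected : ∀ i u v → branch u ≡ just i → branch v ≡ just i →
                WalkIn G (λ w → branch w ≡ just i) u v
    joined    : ∀ i j → i ≢ j →
                Σ (Fin n) λ u → Σ (Fin n) λ v →
                  branch u ≡ just i × branch v ≡ just j × Adj G u v

HasKMinor : ∀ {n} → ℕ → Graph n → Set
HasKMinor m G = KMinorModel m G

-- Induction on |A|, proving for the subgraph G[A] induced by a vertex set A both
-- e(G[A]) ≤ 3|A| − 6 and c(G[A]) ≤ 8(|A| − 2), where c counts cliques (∅ included).
-- Let x have minimum degree δ in G[A]; the edge bound for G[A − x] gives δ ≤ 5.
-- If δ ≤ 3, delete x: the cliques through x are the cliques of N(x), at most 2^δ ≤ 8.
-- If x has a neighbour w with at most two common neighbours, contract xw: this loses
-- 1 + |N(x) ∩ N(w)| ≤ 3 edges and at most 2 · 2² cliques.  Otherwise δ ∈ {4, 5} and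
-- every neighbour of x has three neighbours in N(x); a finite check over all such
-- neighbourhoods then finds a K₅ minor on x and its neighbours.

module Submission where

open import Data.Bool using (Bool; true; false; _∧_; _∨_; not; if_then_else_; T)
open import Data.Bool.ListAction using (all; any)
open import Data.Bool.Properties using (∧-zeroʳ; ∨-zeroʳ; T-≡) renaming (_≟_ to _≟ᵇ_)
open import Data.Empty using (⊥; ⊥-elim)
open import Data.Fin using (Fin; zero; suc; _≟_)
open import Data.Fin.Patterns using (0F; 1F; 2F; 3F; 4F)
open import Data.Fin.Properties using (any?)
open import Data.Fin.Subset using (Subset)
open import Data.List using (List; []; _∷_; map; _++_; length; filterᵇ; cartesianProduct; allFin)
import Data.List.Membership.Propositional as List
open import Data.List.Membership.Propositional.Properties
  using (∈-allFin; ∈-map⁺; ∈-++⁺ˡ; ∈-++⁺ʳ; ∈-cartesianProduct⁺)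
open import Data.List.Properties using (filter-++; length-++)
import Data.List.Relation.Unary.All as All
open import Data.List.Relation.Unary.All.Properties using (all⁺; all⁻; tabulate⁺)
open import Data.List.Relation.Unary.Any using (here; satisfied)
open import Data.List.Relation.Unary.Any.Properties using (any⁻)
open import Data.Maybe using (Maybe; just; nothing)
open import Data.Maybe.Properties using (just-injective)
open import Data.Nat using (ℕ; zero; suc; _+_; _*_; _^_; _∸_; _≤_; _<_; z≤n; s≤s; _≤?_; _<?_; _≤ᵇ_)
open import Data.Nat.Induction using (<-rec)
open import Data.Nat.Properties
  using ( +-*-semiring; +-commutativeSemigroup; +-identityʳ; +-comm; *-suc; suc-injective; 0≢1+n
        ; ≤-refl; ≤-reflexive; ≤-trans; ≤-antisym; ≤-pred; <-irrefl; ≰⇒>; ≮⇒≥; n<1+n; m<m+n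
        ; m≤n⇒m<n∨m≡n; +-mono-≤; +-monoˡ-≤; +-monoʳ-≤; *-monoʳ-≤; ^-monoʳ-≤; +-cancelʳ-≤
        ; ≤⇒≤ᵇ
        ; module ≤-Reasoning )
open import Algebra.Properties.CommutativeSemigroup +-commutativeSemigroup using (x∙yz≈y∙xz; interchange)
open import Algebra.Properties.Semiring.Sum +-*-semiring
  using (sum; sum-cong-≗; sum-replicate-zero; ∑-distrib-+; *-distribʳ-sum)
open import Data.Nat.Tactic.RingSolver using (solve-∀)
open import Data.Product using (Σ; ∃; ∃-syntax; _×_; _,_; proj₁; proj₂)
open import Data.Product.Function.NonDependent.Propositional using (_×-⇔_)
open import Data.Sum using (_⊎_; inj₁; inj₂)
open import Data.Unit using (⊤; tt)
open import Data.Vec using (Vec; []; _∷_; lookup; tabulate; replicate; _[_]≔_)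
open import Data.Vec.Properties using (lookup∘update; lookup∘update′; lookup∘tabulate; lookup-replicate)
open import Function using (_∘_; _⇔_; mk⇔; Equivalence)
open import Function.Construct.Composition using (_⇔-∘_)
open import Function.Construct.Identity using (⇔-id)
open import Function.Construct.Symmetry using (⇔-sym)
open import Function.Definitions using (Injective)
open import Relation.Binary.PropositionalEquality
  using (_≡_; _≢_; _≗_; refl; sym; trans; cong; cong₂; subst; ≢-sym; module ≡-Reasoning)
open import Relation.Nullary using (¬_; yes; no; does)
open import Relation.Nullary.Decidable using (T?; ⌊_⌋; isYes≗does; dec-true; dec-false; _×-dec_)

open import Defs hiding (sym)

variable
  n k m : ℕ

VertexSet : ℕ → Set
VertexSet n = Fin n → Bool

infix 4 _∈_ _⊆_
infixl 6 _-_
infixl 7 _∩_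

-- A record rather than A x ≡ true, so that x and A are inferred from a membership proof.
record _∈_ (x : Fin n) (A : VertexSet n) : Set where
  constructor holds
  field truth : A x ≡ true

open _∈_

_⊆_ : VertexSet n → VertexSet n → Set
A ⊆ B = ∀ {z} → z ∈ A → z ∈ B

_∩_ : VertexSet n → VertexSet n → VertexSet n
(A ∩ B) x = A x ∧ B x

_-_ : VertexSet n → Fin n → VertexSet n
(A - v) x = not (does (x ≟ v)) ∧ A x

∑∈ : VertexSet n → (Fin n → ℕ) → ℕ
∑∈ A f = sum (λ x → if A x then f x else 0)

size : VertexSet n → ℕ
size A = ∑∈ A (λ _ → 1)

⟦_⟧ : Bool → ℕ
⟦ b ⟧ = if b then 1 else 0

variable
  A B : VertexSet n
  u v w x y : Fin n
  f g : Fin n → ℕ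
  G H : Graph n

A∩B⊆A : ∀ (A B : VertexSet n) → A ∩ B ⊆ A
A∩B⊆A A B {x} (holds h) with A x in e
... | true = holds e

A∩B⊆B : ∀ (A B : VertexSet n) → A ∩ B ⊆ B
A∩B⊆B A B {x} (holds h) with A x
... | true = holds h

x∈A∩B⁺ : x ∈ A → x ∈ B → x ∈ A ∩ B
x∈A∩B⁺ (holds xA) (holds xB) = holds (cong₂ _∧_ xA xB)

A-v⊆A : ∀ (A : VertexSet n) v → A - v ⊆ A
A-v⊆A A v {x} (holds h) with x ≟ v
... | no _ = holds h

x∈A-v⇒x≢v : ∀ (A : VertexSet n) v → x ∈ A - v → x ≢ v
x∈A-v⇒x≢v {x = x} A v (holds h) with x ≟ v
x∈A-v⇒x≢v A v (holds ()) | yes _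
... | no x≢v = x≢v

x∈A∧x≢v⇒x∈A-v : x ∈ A → x ≢ v → x ∈ A - v
x∈A∧x≢v⇒x∈A-v {x = x} {v = v} (holds xA) x≢v =
  holds (cong₂ (λ b a → not b ∧ a) (dec-false (x ≟ v) x≢v) xA)

⊆⇒≗∩ : A ⊆ B → A ≗ B ∩ A
⊆⇒≗∩ {A = A} {B = B} A⊆B x with A x in e
... | true  rewrite truth (A⊆B (holds e)) = refl
... | false = sym (∧-zeroʳ (B x))

true≢false : true ≢ false
true≢false ()

≡-from-⇔ : ∀ {a b} → (a ≡ true ⇔ b ≡ true) → a ≡ b
≡-from-⇔ {false} {false} _ = refl
≡-from-⇔ {false} {true}  a⇔b = Equivalence.from a⇔b refl
≡-from-⇔ {true}  {false} a⇔b = sym (Equivalence.to a⇔b refl)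
≡-from-⇔ {true}  {true}  _ = refl

∧-reflects : ∀ {a b} → a ∧ b ≡ true ⇔ (a ≡ true × b ≡ true)
∧-reflects {true}  = mk⇔ (refl ,_) proj₂
∧-reflects {false} = mk⇔ (λ ()) (λ ())

not-∧-reflects : ∀ {a b} → not a ∧ b ≡ true ⇔ (a ≡ false × b ≡ true)
not-∧-reflects {false} = mk⇔ (refl ,_) proj₂
not-∧-reflects {true}  = mk⇔ (λ ()) (λ ())

implies-reflects : ∀ a d c → (not a ∨ d ∨ c) ≡ true ⇔ (a ≡ true → d ≡ false → c ≡ true)
implies-reflects true  false c = mk⇔ (λ h _ _ → h) (λ h → h refl refl)
implies-reflects true  true  c = mk⇔ (λ _ _ ()) (λ _ → refl)
implies-reflects false d     c = mk⇔ (λ _ ()) (λ _ → refl)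

all-allFin-reflects : ∀ (p : Fin n → Bool) → all p (allFin n) ≡ true ⇔ (∀ i → p i ≡ true)
all-allFin-reflects p = mk⇔
  (λ h i → Equivalence.to T-≡ (All.lookup (all⁺ p _ (Equivalence.from T-≡ h)) (∈-allFin i)))
  (λ h → Equivalence.to T-≡ (all⁻ p (tabulate⁺ (λ i → Equivalence.from T-≡ (h i)))))

any-allFin-witness : ∀ (p : Fin n → Bool) → any p (allFin n) ≡ true → ∃[ i ] p i ≡ true
any-allFin-witness {n} p h =
  let (i , pi) = satisfied (any⁻ p (allFin n) (Equivalence.from T-≡ h)) in i , Equivalence.to T-≡ pi

≟-true : does (x ≟ y) ≡ true → x ≡ y
≟-true {x = x} {y = y} h with x ≟ y
... | yes x≡y = x≡y

∨-true : ∀ {a b} → a ∨ b ≡ true → a ≡ true ⊎ b ≡ true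
∨-true {true}  _ = inj₁ refl
∨-true {false} h = inj₂ h

⟦∨⟧+⟦∧⟧ : ∀ a b → ⟦ a ∨ b ⟧ + ⟦ b ∧ a ⟧ ≡ ⟦ a ⟧ + ⟦ b ⟧
⟦∨⟧+⟦∧⟧ true  true  = refl
⟦∨⟧+⟦∧⟧ true  false = refl
⟦∨⟧+⟦∧⟧ false true  = refl
⟦∨⟧+⟦∧⟧ false false = refl

∑∈-cong : (∀ {x} → x ∈ A → f x ≡ g x) → ∑∈ A f ≡ ∑∈ A g
∑∈-cong {A = A} {f = f} {g = g} f≗g = sum-cong-≗ pointwise
  where
  pointwise : ∀ x → (if A x then f x else 0) ≡ (if A x then g x else 0)
  pointwise x with A x in e
  ... | true  = f≗g (holds e)
  ... | false = refl

∑∈-≗ : A ≗ B → ∑∈ A f ≡ ∑∈ B f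
∑∈-≗ {f = f} A≗B = sum-cong-≗ (λ x → cong (λ b → if b then f x else 0) (A≗B x))

∑∈-mono : (∀ {x} → x ∈ A → f x ≤ g x) → ∑∈ A f ≤ ∑∈ A g
∑∈-mono {zero} _ = z≤n
∑∈-mono {suc n} {A = A} {f = f} {g = g} f≤g =
  +-mono-≤ at-zero (∑∈-mono {A = A ∘ suc} (λ h → f≤g (holds (truth h))))
  where
  at-zero : (if A zero then f zero else 0) ≤ (if A zero then g zero else 0)
  at-zero with A zero in e
  ... | true  = f≤g (holds e)
  ... | false = z≤n

∑∈-⊆ : A ⊆ B → ∑∈ A f ≤ ∑∈ B f
∑∈-⊆ {zero} _ = z≤n
∑∈-⊆ {suc n} {A = A} {B = B} {f = f} A⊆B =
  +-mono-≤ at-zero (∑∈-⊆ {A = A ∘ suc} (λ h → holds (truth (A⊆B (holds (truth h))))))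
  where
  at-zero : (if A zero then f zero else 0) ≤ (if B zero then f zero else 0)
  at-zero with A zero in e
  ... | true  rewrite truth (A⊆B (holds e)) = ≤-refl
  ... | false = z≤n

∑∈-remove : v ∈ A → ∑∈ A f ≡ f v + ∑∈ (A - v) f
∑∈-remove {suc n} {v = zero} (holds vA) rewrite vA = refl
∑∈-remove {suc n} {v = suc v} {A = A} {f = f} (holds vA) =
  trans (cong ((if A zero then f zero else 0) +_) (∑∈-remove {A = A ∘ suc} (holds vA)))
        (x∙yz≈y∙xz (if A zero then f zero else 0) (f (suc v)) (∑∈ ((A ∘ suc) - v) (f ∘ suc)))

size-remove : v ∈ A → size A ≡ suc (size (A - v))
size-remove = ∑∈-remove

∑∈-+ : ∑∈ A (λ x → f x + g x) ≡ ∑∈ A f + ∑∈ A g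
∑∈-+ {A = A} {f = f} {g = g} =
  trans (sum-cong-≗ pointwise) (∑-distrib-+ (λ x → if A x then f x else 0) (λ x → if A x then g x else 0))
  where
  pointwise : ∀ x → (if A x then f x + g x else 0) ≡ (if A x then f x else 0) + (if A x then g x else 0)
  pointwise x with A x
  ... | true  = refl
  ... | false = refl

∑∈-const : ∀ (A : VertexSet n) c → ∑∈ A (λ _ → c) ≡ size A * c
∑∈-const A c = sym (trans (*-distribʳ-sum c (λ x → ⟦ A x ⟧)) (sum-cong-≗ pointwise))
  where
  pointwise : ∀ x → ⟦ A x ⟧ * c ≡ (if A x then c else 0)
  pointwise x with A x
  ... | true  = +-identityʳ c
  ... | false = refl

∑∈-∩ : ∀ (A C : VertexSet n) → ∑∈ (A ∩ C) f ≡ ∑∈ A (λ x → if C x then f x else 0)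
∑∈-∩ {f = f} A C = sum-cong-≗ pointwise
  where
  pointwise : ∀ x → (if A x ∧ C x then f x else 0) ≡ (if A x then (if C x then f x else 0) else 0)
  pointwise x with A x
  ... | true  = refl
  ... | false = refl

∑∈-∅ : ∀ {n} {A : VertexSet n} {f} → (∀ x → ¬ x ∈ A) → ∑∈ A f ≡ 0
∑∈-∅ {n} {A} {f} empty = trans (sum-cong-≗ pointwise) (sum-replicate-zero n)
  where
  pointwise : ∀ x → (if A x then f x else 0) ≡ 0
  pointwise x with A x in e
  ... | true  = ⊥-elim (empty x (holds e))
  ... | false = refl

nonempty : size A ≡ suc k → ∃[ x ] x ∈ A
nonempty {A = A} size≡ with any? (λ x → A x ≟ᵇ true)
... | yes (x , e) = x , holds e
... | no none     = ⊥-elim (0≢1+n (trans (sym (∑∈-∅ {A = A} λ x xA → none (x , truth xA))) size≡))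

size≡0⇒∑∈≡0 : size A ≡ 0 → ∑∈ A f ≡ 0
size≡0⇒∑∈≡0 {A = A} size≡0 = ∑∈-∅ {A = A} λ x xA → 0≢1+n (trans (sym size≡0) (size-remove xA))

minimiser : (f : Fin n → ℕ) → x ∈ A → ∃[ y ] (y ∈ A × ∀ {z} → z ∈ A → f y ≤ f z)
minimiser {n = n} {x = x} {A = A} f xA = <-rec P descend (f x) x refl xA
  where
  P : ℕ → Set
  P k = ∀ x → f x ≡ k → x ∈ A → ∃[ y ] (y ∈ A × ∀ {z} → z ∈ A → f y ≤ f z)
  descend : ∀ k → (∀ {j} → j < k → P j) → P k
  descend _ smaller x refl xA with any? (λ z → (A z ≟ᵇ true) ×-dec (f z <? f x))
  ... | yes (z , zA , fz<fx) = smaller fz<fx z refl (holds zA)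
  ... | no none = x , xA , λ {z} zA → ≮⇒≥ (λ fz<fx → none (z , truth zA , fz<fx))

record Enumeration (B : VertexSet n) (k : ℕ) : Set where
  field
    elt       : Fin k → Fin n
    injective : Injective _≡_ _≡_ elt
    member    : ∀ i → elt i ∈ B
    ∑∈-elt    : ∀ f → ∑∈ B f ≡ sum (f ∘ elt)

enumerate : ∀ {n k} (B : VertexSet n) → size B ≡ k → Enumeration B k
enumerate {k = zero} B size≡0 = record
  { elt = λ () ; injective = λ {} ; member = λ () ; ∑∈-elt = λ f → size≡0⇒∑∈≡0 {A = B} size≡0 }
enumerate {n} {suc k} B size≡ = record
  { elt = elt ; injective = injective ; member = member
  ; ∑∈-elt = λ f → trans (∑∈-remove bB) (cong (f b +_) (∑∈-elt f)) }
  where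
  b : Fin n
  b = proj₁ (nonempty {A = B} size≡)
  bB : b ∈ B
  bB = proj₂ (nonempty {A = B} size≡)
  open Enumeration (enumerate (B - b) (suc-injective (trans (sym (size-remove bB)) size≡)))
    renaming (elt to elt′; injective to injective′; member to member′)
  elt : Fin (suc k) → Fin n
  elt zero    = b
  elt (suc i) = elt′ i
  member : ∀ i → elt i ∈ B
  member zero    = bB
  member (suc i) = A-v⊆A B b (member′ i)
  injective : Injective _≡_ _≡_ elt
  injective {zero}  {zero}  _ = refl
  injective {zero}  {suc j} b≡ = ⊥-elim (x∈A-v⇒x≢v B b (member′ j) (sym b≡))
  injective {suc i} {zero}  ≡b = ⊥-elim (x∈A-v⇒x≢v B b (member′ i) ≡b)
  injective {suc i} {suc j} e = cong suc (injective′ e)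

-- Degrees and degree sums

nbrs : Graph n → VertexSet n → Fin n → VertexSet n
nbrs G A v = A ∩ adj G v

deg : Graph n → VertexSet n → Fin n → ℕ
deg G A v = size (nbrs G A v)

degreeSum : Graph n → VertexSet n → ℕ
degreeSum G A = ∑∈ A (deg G A)

adj-≢ : ∀ (G : Graph n) → adj G x y ≡ true → x ≢ y
adj-≢ {x = x} G xy refl = true≢false (trans (sym xy) (irrefl G x))

nbrs⊆A-v : ∀ (G : Graph n) A v → nbrs G A v ⊆ A - v
nbrs⊆A-v G A v h =
  x∈A∧x≢v⇒x∈A-v (A∩B⊆A A (adj G v) h) (λ { refl → adj-≢ G (truth (A∩B⊆B A (adj G v) h)) refl })

deg<size : ∀ (G : Graph n) → v ∈ A → deg G A v < size A
deg<size {v = v} {A = A} G vA = begin-strict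
  deg G A v           ≤⟨ ∑∈-⊆ (nbrs⊆A-v G A v) ⟩
  size (A - v)        <⟨ n<1+n _ ⟩
  suc (size (A - v))  ≡⟨ sym (size-remove vA) ⟩
  size A              ∎
  where open ≤-Reasoning

deg-remove : ∀ (G : Graph n) x → w ∈ A → deg G A x ≡ ⟦ adj G x w ⟧ + deg G (A - w) x
deg-remove {w = w} {A = A} G x wA = begin
  deg G A x                                         ≡⟨ ∑∈-∩ A (adj G x) ⟩
  ∑∈ A (λ y → ⟦ adj G x y ⟧)                        ≡⟨ ∑∈-remove wA ⟩
  ⟦ adj G x w ⟧ + ∑∈ (A - w) (λ y → ⟦ adj G x y ⟧)
    ≡⟨ cong (⟦ adj G x w ⟧ +_) (∑∈-∩ (A - w) (adj G x)) ⟨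
  ⟦ adj G x w ⟧ + deg G (A - w) x                   ∎
  where open ≡-Reasoning

deg-remove-self : ∀ (G : Graph n) → x ∈ A → deg G A x ≡ deg G (A - x) x
deg-remove-self {x = x} {A = A} G xA =
  trans (deg-remove G x xA) (cong (λ b → ⟦ b ⟧ + deg G (A - x) x) (irrefl G x))

AgreeOn : VertexSet n → Graph n → Graph n → Set
AgreeOn A G H = ∀ {x y} → x ∈ A → y ∈ A → adj G x y ≡ adj H x y

deg-cong : ∀ (G H : Graph n) → AgreeOn A G H → x ∈ A → deg G A x ≡ deg H A x
deg-cong {A = A} {x = x} G H agree xA = begin
  deg G A x                         ≡⟨ ∑∈-∩ A (adj G x) ⟩
  ∑∈ A (λ y → ⟦ adj G x y ⟧)        ≡⟨ ∑∈-cong (λ yA → cong ⟦_⟧ (agree xA yA)) ⟩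
  ∑∈ A (λ y → ⟦ adj H x y ⟧)        ≡⟨ sym (∑∈-∩ A (adj H x)) ⟩
  deg H A x                         ∎
  where open ≡-Reasoning

degreeSum-cong : ∀ (G H : Graph n) → AgreeOn A G H → degreeSum G A ≡ degreeSum H A
degreeSum-cong G H agree = ∑∈-cong (deg-cong G H agree)

degreeSum-remove : ∀ (G : Graph n) → w ∈ A → degreeSum G A ≡ degreeSum G (A - w) + 2 * deg G (A - w) w
degreeSum-remove {w = w} {A = A} G wA = begin
  degreeSum G A
    ≡⟨ ∑∈-remove wA ⟩
  deg G A w + ∑∈ (A - w) (deg G A)
    ≡⟨ cong₂ _+_ (deg-remove-self G wA) (∑∈-cong {A = A - w} (λ {x} _ → deg-remove G x wA)) ⟩
  d + ∑∈ (A - w) (λ x → ⟦ adj G x w ⟧ + deg G (A - w) x)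
    ≡⟨ cong (d +_) (∑∈-+ {A = A - w}) ⟩
  d + (∑∈ (A - w) (λ x → ⟦ adj G x w ⟧) + degreeSum G (A - w))
    ≡⟨ cong (λ e → d + (e + degreeSum G (A - w))) edges-to-w ⟩
  d + (d + degreeSum G (A - w))
    ≡⟨ rearrange d (degreeSum G (A - w)) ⟩
  degreeSum G (A - w) + 2 * d
    ∎
  where
  open ≡-Reasoning
  d : ℕ
  d = deg G (A - w) w
  rearrange : ∀ d D → d + (d + D) ≡ D + 2 * d
  rearrange = solve-∀
  edges-to-w : ∑∈ (A - w) (λ x → ⟦ adj G x w ⟧) ≡ d
  edges-to-w = trans (∑∈-cong {A = A - w} (λ {x} _ → cong ⟦_⟧ (Graph.sym G x w)))
                     (sym (∑∈-∩ (A - w) (adj G w)))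

degreeSum-≤ : ∀ (G : Graph n) c → (∀ {x} → x ∈ A → deg G A x ≤ c) → degreeSum G A ≤ size A * c
degreeSum-≤ {A = A} G c bound = ≤-trans (∑∈-mono bound) (≤-reflexive (∑∈-const A c))

degreeSum-≥ : ∀ (G : Graph n) c → (∀ {x} → x ∈ A → c ≤ deg G A x) → size A * c ≤ degreeSum G A
degreeSum-≥ {A = A} G c bound = ≤-trans (≤-reflexive (sym (∑∈-const A c))) (∑∈-mono bound)

-- Contracting an edge

-- u is joined to N(u) ∪ N(v); v itself stays, and is dropped by passing to A - v.
contract : Graph n → Fin n → Fin n → Graph n
contract {n} G u v = record { adj = adj′ ; sym = adj′-sym ; irrefl = adj′-irrefl }
  where
  merged : Fin n → Bool
  merged y = adj G u y ∨ adj G v y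
  adj′ : Fin n → Fin n → Bool
  adj′ x y with x ≟ u | y ≟ u
  ... | yes _ | yes _ = false
  ... | yes _ | no _  = merged y
  ... | no _  | yes _ = merged x
  ... | no _  | no _  = adj G x y
  adj′-sym : ∀ x y → adj′ x y ≡ adj′ y x
  adj′-sym x y with x ≟ u | y ≟ u
  ... | yes _ | yes _ = refl
  ... | yes _ | no _  = refl
  ... | no _  | yes _ = refl
  ... | no _  | no _  = Graph.sym G x y
  adj′-irrefl : ∀ x → adj′ x x ≡ false
  adj′-irrefl x with x ≟ u
  ... | yes _ = refl
  ... | no _  = irrefl G x

contract-agrees : ∀ (G : Graph n) u v → ¬ u ∈ A → AgreeOn A G (contract G u v)
contract-agrees G u v u∉A {x} {y} xA yA with x ≟ u | y ≟ u
... | yes refl | _        = ⊥-elim (u∉A xA)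
... | no _     | yes refl = ⊥-elim (u∉A yA)
... | no _     | no _     = refl

contract-edge : ∀ (G : Graph n) u v → adj (contract G u v) x y ≡ true →
                adj G x y ≡ true ⊎ (x ≡ u × adj G v y ≡ true) ⊎ (y ≡ u × adj G x v ≡ true)
contract-edge {x = x} {y = y} G u v e with x ≟ u | y ≟ u
... | yes refl | no _ with ∨-true e
...   | inj₁ uy = inj₁ uy
...   | inj₂ vy = inj₂ (inj₁ (refl , vy))
contract-edge {x = x} {y = y} G u v e | no _ | yes refl with ∨-true e
...   | inj₁ ux = inj₁ (trans (Graph.sym G x u) ux)
...   | inj₂ vx = inj₂ (inj₂ (refl , trans (Graph.sym G x v) vx))
contract-edge G u v e | no _ | no _ = inj₁ e

contract-adj-u : ∀ (G : Graph n) u v → y ≢ u → adj (contract G u v) u y ≡ adj G u y ∨ adj G v y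
contract-adj-u {y = y} G u v y≢u with u ≟ u | y ≟ u
... | no u≢u | _        = ⊥-elim (u≢u refl)
... | yes _  | yes y≡u  = ⊥-elim (y≢u y≡u)
... | yes _  | no _     = refl

degreeSum-contract : ∀ (G : Graph n) → u ∈ A → v ∈ A → adj G u v ≡ true →
  degreeSum G A ≡ degreeSum (contract G u v) (A - v) + 2 * suc (size (nbrs G (nbrs G A v) u))
degreeSum-contract {u = u} {A = A} {v = v} G uA vA uv = begin
  degreeSum G A
    ≡⟨ degreeSum-remove G vA ⟩
  degreeSum G A₁ + 2 * deg G A₁ v
    ≡⟨ cong₂ (λ D d → D + 2 * d) (degreeSum-remove G uA₁) deg-v ⟩
  degreeSum G A₂ + 2 * deg G A₂ u + 2 * suc (deg G A₂ v)
    ≡⟨ cong (λ D → D + 2 * deg G A₂ u + 2 * suc (deg G A₂ v))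
            (degreeSum-cong G G′ (contract-agrees G u v u∉A₂)) ⟩
  degreeSum G′ A₂ + 2 * deg G A₂ u + 2 * suc (deg G A₂ v)
    ≡⟨ rebalance (degreeSum G′ A₂) (sym merged-degree) ⟩
  degreeSum G′ A₂ + 2 * deg G′ A₂ u + 2 * suc (size C)
    ≡⟨ cong (_+ 2 * suc (size C)) (degreeSum-remove G′ uA₁) ⟨
  degreeSum G′ A₁ + 2 * suc (size C)
    ∎
  where
  open ≡-Reasoning
  G′ : Graph _
  G′ = contract G u v
  A₁ A₂ C : VertexSet _
  A₁ = A - v
  A₂ = A₁ - u
  C  = nbrs G (nbrs G A v) u
  uA₁ : u ∈ A₁
  uA₁ = x∈A∧x≢v⇒x∈A-v uA (adj-≢ G uv)
  u∉A₂ : ¬ u ∈ A₂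
  u∉A₂ h = x∈A-v⇒x≢v A₁ u h refl
  deg-v : deg G A₁ v ≡ suc (deg G A₂ v)
  deg-v = trans (deg-remove G v uA₁) (cong (λ b → ⟦ b ⟧ + deg G A₂ v) (trans (Graph.sym G v u) uv))
  C⊆A₂ : C ⊆ A₂
  C⊆A₂ {y} yC = x∈A∧x≢v⇒x∈A-v (x∈A∧x≢v⇒x∈A-v yA (≢-sym (adj-≢ G vy))) (≢-sym (adj-≢ G uy))
    where
    yNv : y ∈ nbrs G A v
    yNv = A∩B⊆A (nbrs G A v) (adj G u) yC
    yA : y ∈ A
    yA = A∩B⊆A A (adj G v) yNv
    vy : adj G v y ≡ true
    vy = truth (A∩B⊆B A (adj G v) yNv)
    uy : adj G u y ≡ true
    uy = truth (A∩B⊆B (nbrs G A v) (adj G u) yC)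
  pointwise : ∀ {y} → y ∈ A₂ → ⟦ adj G′ u y ⟧ + ⟦ C y ⟧ ≡ ⟦ adj G u y ⟧ + ⟦ adj G v y ⟧
  pointwise {y} yA₂ = begin
    ⟦ adj G′ u y ⟧ + ⟦ C y ⟧
      ≡⟨ cong₂ (λ a c → ⟦ a ⟧ + ⟦ c ⟧) u-adj C-adj ⟩
    ⟦ adj G u y ∨ adj G v y ⟧ + ⟦ adj G v y ∧ adj G u y ⟧
      ≡⟨ ⟦∨⟧+⟦∧⟧ (adj G u y) (adj G v y) ⟩
    ⟦ adj G u y ⟧ + ⟦ adj G v y ⟧
      ∎
    where
    u-adj : adj G′ u y ≡ adj G u y ∨ adj G v y
    u-adj = contract-adj-u G u v (x∈A-v⇒x≢v A₁ u yA₂)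
    C-adj : C y ≡ adj G v y ∧ adj G u y
    C-adj = cong (λ t → (t ∧ adj G v y) ∧ adj G u y) (truth (A-v⊆A A v (A-v⊆A A₁ u yA₂)))
  merged-degree : deg G′ A₂ u + size C ≡ deg G A₂ u + deg G A₂ v
  merged-degree = begin
    deg G′ A₂ u + size C
      ≡⟨ cong₂ _+_ (∑∈-∩ A₂ (adj G′ u)) (trans (∑∈-≗ (⊆⇒≗∩ C⊆A₂)) (∑∈-∩ A₂ C)) ⟩
    ∑∈ A₂ (λ y → ⟦ adj G′ u y ⟧) + ∑∈ A₂ (λ y → ⟦ C y ⟧)
      ≡⟨ ∑∈-+ {A = A₂} ⟨
    ∑∈ A₂ (λ y → ⟦ adj G′ u y ⟧ + ⟦ C y ⟧)
      ≡⟨ ∑∈-cong {A = A₂} pointwise ⟩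
    ∑∈ A₂ (λ y → ⟦ adj G u y ⟧ + ⟦ adj G v y ⟧)
      ≡⟨ ∑∈-+ {A = A₂} ⟩
    ∑∈ A₂ (λ y → ⟦ adj G u y ⟧) + ∑∈ A₂ (λ y → ⟦ adj G v y ⟧)
      ≡⟨ cong₂ _+_ (∑∈-∩ A₂ (adj G u)) (∑∈-∩ A₂ (adj G v)) ⟨
    deg G A₂ u + deg G A₂ v
      ∎
  rebalance : ∀ D {a b a′ c} → a + b ≡ a′ + c → D + 2 * a + 2 * suc b ≡ D + 2 * a′ + 2 * suc c
  rebalance D {a} {b} {a′} {c} eq = begin
    D + 2 * a + 2 * suc b      ≡⟨ regroup D a b ⟩
    D + 2 + 2 * (a + b)        ≡⟨ cong (λ s → D + 2 + 2 * s) eq ⟩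
    D + 2 + 2 * (a′ + c)       ≡⟨ regroup D a′ c ⟨
    D + 2 * a′ + 2 * suc c     ∎
    where
    regroup : ∀ D a b → D + 2 * a + 2 * suc b ≡ D + 2 + 2 * (a + b)
    regroup = solve-∀

count : (Subset n → Bool) → ℕ
count {zero}  P = ⟦ P [] ⟧
count {suc n} P = count (P ∘ (true ∷_)) + count (P ∘ (false ∷_))

count-cong : ∀ {P Q : Subset n → Bool} → (∀ S → P S ≡ Q S) → count P ≡ count Q
count-cong {zero}  P≗Q = cong ⟦_⟧ (P≗Q [])
count-cong {suc n} P≗Q = cong₂ _+_ (count-cong (P≗Q ∘ (true ∷_))) (count-cong (P≗Q ∘ (false ∷_)))

count-mono : ∀ {P Q : Subset n → Bool} → (∀ S → P S ≡ true → Q S ≡ true) → count P ≤ count Q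
count-mono {zero} {P} {Q} P⇒Q with P [] in e
... | true  rewrite P⇒Q [] e = ≤-refl
... | false = z≤n
count-mono {suc n} P⇒Q = +-mono-≤ (count-mono (P⇒Q ∘ (true ∷_))) (count-mono (P⇒Q ∘ (false ∷_)))

count-additive : ∀ {P Q R T : Subset n → Bool} → (∀ S → ⟦ P S ⟧ + ⟦ Q S ⟧ ≡ ⟦ R S ⟧ + ⟦ T S ⟧) →
                 count P + count Q ≡ count R + count T
count-additive {zero}  pointwise = pointwise []
count-additive {suc n} {P} {Q} {R} {T} pointwise = begin
  count P + count Q                                     ≡⟨ interchange (count (P ∘ (true ∷_))) _ _ _ ⟩
  (count (P ∘ (true ∷_)) + count (Q ∘ (true ∷_))) + (count (P ∘ (false ∷_)) + count (Q ∘ (false ∷_)))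
      ≡⟨ cong₂ _+_ (count-additive (pointwise ∘ (true ∷_))) (count-additive (pointwise ∘ (false ∷_))) ⟩
  (count (R ∘ (true ∷_)) + count (T ∘ (true ∷_))) + (count (R ∘ (false ∷_)) + count (T ∘ (false ∷_)))
      ≡⟨ interchange (count (R ∘ (true ∷_))) _ _ _ ⟩
  count R + count T                                     ∎
  where open ≡-Reasoning

count-none : count {n} (λ _ → false) ≡ 0
count-none {zero}  = refl
count-none {suc n} = cong₂ _+_ (count-none {n}) (count-none {n})

count-split : ∀ v (P : Subset n → Bool) →
              count P ≡ count (λ S → lookup S v ∧ P S) + count (λ S → not (lookup S v) ∧ P S)
count-split {n} v P = begin
  count P                          ≡⟨ +-identityʳ (count P) ⟨
  count P + 0                      ≡⟨ cong (count P +_) (count-none {n}) ⟨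
  count P + count {n} (λ _ → false) ≡⟨ count-additive pointwise ⟩
  count (λ S → lookup S v ∧ P S) + count (λ S → not (lookup S v) ∧ P S) ∎
  where
  open ≡-Reasoning
  pointwise : ∀ S → ⟦ P S ⟧ + 0 ≡ ⟦ lookup S v ∧ P S ⟧ + ⟦ not (lookup S v) ∧ P S ⟧
  pointwise S with lookup S v
  ... | true  = refl
  ... | false = +-comm ⟦ P S ⟧ 0

count-insert : ∀ v (P : Subset n → Bool) →
               count (λ S → lookup S v ∧ P S) ≡ count (λ S → not (lookup S v) ∧ P (S [ v ]≔ true))
count-insert {suc n} zero P =
  trans (cong (count (P ∘ (true ∷_)) +_) (count-none {n}))
        (trans (+-comm (count (P ∘ (true ∷_))) 0) (cong (_+ count (P ∘ (true ∷_))) (sym (count-none {n}))))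
count-insert {suc n} (suc v) P =
  cong₂ _+_ (count-insert v (P ∘ (true ∷_))) (count-insert v (P ∘ (false ∷_)))

length-filter-map : ∀ {A B : Set} (p : B → Bool) (f : A → B) xs →
                    length (filterᵇ p (map f xs)) ≡ length (filterᵇ (p ∘ f) xs)
length-filter-map p f [] = refl
length-filter-map p f (x ∷ xs) with p (f x)
... | true  = cong suc (length-filter-map p f xs)
... | false = length-filter-map p f xs

length-filter-allSubsets : ∀ (P : Subset n → Bool) → length (filterᵇ P (allSubsets n)) ≡ count P
length-filter-allSubsets {zero} P with P []
... | true  = refl
... | false = refl
length-filter-allSubsets {suc n} P = begin
  length (filterᵇ P (T₊ ++ F₊))                         ≡⟨ cong length (filter-++ (T? ∘ P) T₊ F₊) ⟩
  length (filterᵇ P T₊ ++ filterᵇ P F₊)                 ≡⟨ length-++ (filterᵇ P T₊) ⟩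
  length (filterᵇ P T₊) + length (filterᵇ P F₊)         ≡⟨ cong₂ _+_ (half true) (half false) ⟩
  count P                                               ∎
  where
  open ≡-Reasoning
  T₊ F₊ : List (Subset (suc n))
  T₊ = map (true ∷_) (allSubsets n)
  F₊ = map (false ∷_) (allSubsets n)
  half : ∀ b → length (filterᵇ P (map (b ∷_) (allSubsets n))) ≡ count (P ∘ (b ∷_))
  half b = trans (length-filter-map P (b ∷_) (allSubsets n)) (length-filter-allSubsets (P ∘ (b ∷_)))

-- Cliques

_⊆ᵇ_ : Subset n → VertexSet n → Bool
[]      ⊆ᵇ B = true
(s ∷ S) ⊆ᵇ B = (not s ∨ B zero) ∧ (S ⊆ᵇ (B ∘ suc))

⊆ᵇ-reflects : ∀ (S : Subset n) B → S ⊆ᵇ B ≡ true ⇔ lookup S ⊆ B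
⊆ᵇ-reflects []      B = mk⇔ (λ _ {x} → ⊥-elim (case x)) (λ _ → refl)
  where
  case : Fin 0 → ⊥
  case ()
⊆ᵇ-reflects (true  ∷ S) B = mk⇔ to from
  where
  open Equivalence (⊆ᵇ-reflects S (B ∘ suc)) renaming (to to to-tail; from to from-tail)
  to : B zero ∧ (S ⊆ᵇ (B ∘ suc)) ≡ true → lookup (true ∷ S) ⊆ B
  to h {zero}  _  with B zero in e
  ... | true  = holds e
  to h {suc x} xS with B zero
  ... | true  = holds (truth (to-tail h (holds (truth xS))))
  from : lookup (true ∷ S) ⊆ B → B zero ∧ (S ⊆ᵇ (B ∘ suc)) ≡ true
  from sub = cong₂ _∧_ (truth (sub {zero} (holds refl)))
                       (from-tail (λ xS → holds (truth (sub (holds (truth xS))))))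
⊆ᵇ-reflects (false ∷ S) B = mk⇔ to from
  where
  open Equivalence (⊆ᵇ-reflects S (B ∘ suc)) renaming (to to to-tail; from to from-tail)
  to : S ⊆ᵇ (B ∘ suc) ≡ true → lookup (false ∷ S) ⊆ B
  to h {suc x} xS = holds (truth (to-tail h (holds (truth xS))))
  from : lookup (false ∷ S) ⊆ B → S ⊆ᵇ (B ∘ suc) ≡ true
  from sub = from-tail (λ xS → holds (truth (sub (holds (truth xS)))))

IsClique : Graph n → VertexSet n → Set
IsClique G A = ∀ {x y} → x ∈ A → y ∈ A → x ≢ y → adj G x y ≡ true

isCliqueᵇ-reflects : ∀ (G : Graph n) S → isCliqueᵇ G S ≡ true ⇔ IsClique G (lookup S)
isCliqueᵇ-reflects G S = mk⇔ sound complete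
  where
  open Equivalence using (to; from)
  pair : Fin _ → Fin _ → Bool
  pair x y = not (lookup S x ∧ lookup S y) ∨ ⌊ x ≟ y ⌋ ∨ adj G x y
  pair-reflects : ∀ x y →
    pair x y ≡ true ⇔ (lookup S x ∧ lookup S y ≡ true → ⌊ x ≟ y ⌋ ≡ false → adj G x y ≡ true)
  pair-reflects x y = implies-reflects (lookup S x ∧ lookup S y) ⌊ x ≟ y ⌋ (adj G x y)
  ⌊≟⌋≡does : ∀ x y → ⌊ x ≟ y ⌋ ≡ does (x ≟ y)
  ⌊≟⌋≡does x y = isYes≗does (x ≟ y)
  sound : isCliqueᵇ G S ≡ true → IsClique G (lookup S)
  sound h {x} {y} (holds xS) (holds yS) x≢y =
    to (pair-reflects x y) (to (all-allFin-reflects (pair x)) (to (all-allFin-reflects _) h x) y)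
       (cong₂ _∧_ xS yS) (trans (⌊≟⌋≡does x y) (dec-false (x ≟ y) x≢y))
  complete : IsClique G (lookup S) → isCliqueᵇ G S ≡ true
  complete clique = from (all-allFin-reflects _) λ x → from (all-allFin-reflects _) λ y →
    from (pair-reflects x y) λ xyS x≠y →
      let (xS , yS) = to ∧-reflects xyS in
      clique (holds xS) (holds yS)
             (λ x≡y → true≢false (trans (sym (trans (⌊≟⌋≡does x y) (dec-true (x ≟ y) x≡y))) x≠y))

CliqueIn : Graph n → VertexSet n → VertexSet n → Set
CliqueIn G B A = A ⊆ B × IsClique G A

cliqueInᵇ : Graph n → VertexSet n → Subset n → Bool
cliqueInᵇ G B S = S ⊆ᵇ B ∧ isCliqueᵇ G S

cliqueInᵇ-reflects : ∀ (G : Graph n) B S → cliqueInᵇ G B S ≡ true ⇔ CliqueIn G B (lookup S)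
cliqueInᵇ-reflects G B S = (⊆ᵇ-reflects S B ×-⇔ isCliqueᵇ-reflects G S) ⇔-∘ ∧-reflects

cliques : Graph n → VertexSet n → ℕ
cliques G B = count (cliqueInᵇ G B)

numCliques≡cliques : ∀ (G : Graph n) → numCliques G ≡ cliques G (λ _ → true)
numCliques≡cliques G =
  trans (length-filter-allSubsets (isCliqueᵇ G)) (count-cong λ S → cong (_∧ isCliqueᵇ G S) (sym (all⊆ S)))
  where
  all⊆ : ∀ S → S ⊆ᵇ (λ _ → true) ≡ true
  all⊆ S = Equivalence.from (⊆ᵇ-reflects S (λ _ → true)) (λ _ → holds refl)

count-subsets : ∀ (B : VertexSet n) → count (_⊆ᵇ B) ≡ 2 ^ size B
count-subsets {zero}  B = refl
count-subsets {suc n} B with B zero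
... | true  rewrite count-subsets (B ∘ suc) = cong (2 ^ size (B ∘ suc) +_) (sym (+-identityʳ _))
... | false rewrite count-subsets (B ∘ suc) | count-none {n} = refl

cliques≤2^size : ∀ (G : Graph n) B → cliques G B ≤ 2 ^ size B
cliques≤2^size G B = begin
  count (cliqueInᵇ G B)  ≤⟨ count-mono {P = cliqueInᵇ G B} (λ S h → proj₁ (Equivalence.to ∧-reflects h)) ⟩
  count (_⊆ᵇ B)          ≡⟨ count-subsets B ⟩
  2 ^ size B             ∎
  where open ≤-Reasoning

cliqueIn-remove : ∀ (G : Graph n) B v → (A v ≡ false × CliqueIn G B A) ⇔ CliqueIn G (B - v) A
cliqueIn-remove {A = A} G B v = mk⇔ to from
  where
  to : A v ≡ false × CliqueIn G B A → CliqueIn G (B - v) A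
  to (v∉A , A⊆B , clique) =
    (λ xA → x∈A∧x≢v⇒x∈A-v (A⊆B xA) (λ { refl → true≢false (trans (sym (truth xA)) v∉A) })) , clique
  from : CliqueIn G (B - v) A → A v ≡ false × CliqueIn G B A
  from (A⊆B-v , clique) = v∉A , (λ xA → A-v⊆A B v (A⊆B-v xA)) , clique
    where
    v∉A : A v ≡ false
    v∉A with A v in e
    ... | true  = ⊥-elim (x∈A-v⇒x≢v B v (A⊆B-v (holds e)) refl)
    ... | false = refl

∈-insert : ∀ (S : Subset n) v → x ∈ lookup (S [ v ]≔ true) ⇔ (x ≡ v ⊎ x ∈ lookup S)
∈-insert {x = x} S v = mk⇔ split join
  where
  split : x ∈ lookup (S [ v ]≔ true) → x ≡ v ⊎ x ∈ lookup S
  split (holds h) with x ≟ v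
  ... | yes x≡v = inj₁ x≡v
  ... | no x≢v  = inj₂ (holds (trans (sym (lookup∘update′ x≢v S true)) h))
  join : x ≡ v ⊎ x ∈ lookup S → x ∈ lookup (S [ v ]≔ true)
  join (inj₁ refl)      = holds (lookup∘update x S true)
  join (inj₂ (holds h)) with x ≟ v
  ... | yes refl = holds (lookup∘update x S true)
  ... | no x≢v   = holds (trans (lookup∘update′ x≢v S true) h)

cliqueIn-insert : ∀ (G : Graph n) {A′} → v ∈ B → (∀ {x} → x ∈ A′ ⇔ (x ≡ v ⊎ x ∈ A)) →
                  (A v ≡ false × CliqueIn G B A′) ⇔ CliqueIn G (nbrs G B v) A
cliqueIn-insert {v = v} {B = B} {A = A} G {A′} vB A′≡A+v = mk⇔ to from
  where
  split : ∀ {x} → x ∈ A′ → x ≡ v ⊎ x ∈ A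
  split = Equivalence.to A′≡A+v
  join : ∀ {x} → x ≡ v ⊎ x ∈ A → x ∈ A′
  join = Equivalence.from A′≡A+v
  to : A v ≡ false × CliqueIn G B A′ → CliqueIn G (nbrs G B v) A
  to (v∉A , A′⊆B , clique′) = A⊆N , (λ xA yA → clique′ (join (inj₂ xA)) (join (inj₂ yA)))
    where
    A⊆N : A ⊆ nbrs G B v
    A⊆N {x} xA =
      x∈A∩B⁺ (A′⊆B (join (inj₂ xA))) (holds (clique′ (join (inj₁ refl)) (join (inj₂ xA)) v≢x))
      where
      v≢x : v ≢ x
      v≢x refl = true≢false (trans (sym (truth xA)) v∉A)
  from : CliqueIn G (nbrs G B v) A → A v ≡ false × CliqueIn G B A′
  from (A⊆N , clique) = v∉A , A′⊆B , clique′
    where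
    v∉A : A v ≡ false
    v∉A with A v in e
    ... | true  = ⊥-elim (adj-≢ G (truth (A∩B⊆B B (adj G v) (A⊆N (holds e)))) refl)
    ... | false = refl
    A′⊆B : A′ ⊆ B
    A′⊆B xA′ with split xA′
    ... | inj₁ refl = vB
    ... | inj₂ xA   = A∩B⊆A B (adj G v) (A⊆N xA)
    clique′ : IsClique G A′
    clique′ {x} {y} xA′ yA′ x≢y with split xA′ | split yA′
    ... | inj₁ refl | inj₁ refl = ⊥-elim (x≢y refl)
    ... | inj₁ refl | inj₂ yA   = truth (A∩B⊆B B (adj G v) (A⊆N yA))
    ... | inj₂ xA   | inj₁ refl = trans (Graph.sym G x v) (truth (A∩B⊆B B (adj G v) (A⊆N xA)))
    ... | inj₂ xA   | inj₂ yA   = clique xA yA x≢y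

cliques-remove : ∀ (G : Graph n) → v ∈ B → cliques G B ≡ cliques G (B - v) + cliques G (nbrs G B v)
cliques-remove {v = v} {B = B} G vB = begin
  cliques G B
    ≡⟨ count-split v P ⟩
  count (λ S → lookup S v ∧ P S) + count (λ S → not (lookup S v) ∧ P S)
    ≡⟨ cong₂ _+_ (trans (count-insert v P) (count-cong containing-v)) (count-cong avoiding-v) ⟩
  cliques G (nbrs G B v) + cliques G (B - v)
    ≡⟨ +-comm (cliques G (nbrs G B v)) (cliques G (B - v)) ⟩
  cliques G (B - v) + cliques G (nbrs G B v)
    ∎
  where
  open ≡-Reasoning
  P : Subset _ → Bool
  P = cliqueInᵇ G B
  avoiding-v : ∀ S → not (lookup S v) ∧ P S ≡ cliqueInᵇ G (B - v) S
  avoiding-v S = ≡-from-⇔ (⇔-sym (cliqueInᵇ-reflects G (B - v) S)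
                  ⇔-∘ (cliqueIn-remove G B v
                  ⇔-∘ ((⇔-id _ ×-⇔ cliqueInᵇ-reflects G B S) ⇔-∘ not-∧-reflects)))
  containing-v : ∀ S → not (lookup S v) ∧ P (S [ v ]≔ true) ≡ cliqueInᵇ G (nbrs G B v) S
  containing-v S = ≡-from-⇔ (⇔-sym (cliqueInᵇ-reflects G (nbrs G B v) S)
                    ⇔-∘ (cliqueIn-insert G vB (∈-insert S v)
                    ⇔-∘ ((⇔-id _ ×-⇔ cliqueInᵇ-reflects G B (S [ v ]≔ true)) ⇔-∘ not-∧-reflects)))

cliqueInᵇ-mono : ∀ (G : Graph n) {B B′} → B ⊆ B′ →
                 ∀ S → cliqueInᵇ G B S ≡ true → cliqueInᵇ G B′ S ≡ true
cliqueInᵇ-mono G {B} {B′} B⊆B′ S h with Equivalence.to (cliqueInᵇ-reflects G B S) h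
... | S⊆B , clique = Equivalence.from (cliqueInᵇ-reflects G B′ S) ((B⊆B′ ∘ S⊆B) , clique)

cliques-cong : ∀ (G H : Graph n) → AgreeOn B G H → cliques G B ≡ cliques H B
cliques-cong {B = B} G H agree = count-cong λ S →
  ≡-from-⇔ (⇔-sym (cliqueInᵇ-reflects H B S) ⇔-∘ (transfer ⇔-∘ cliqueInᵇ-reflects G B S))
  where
  transfer : ∀ {A} → CliqueIn G B A ⇔ CliqueIn H B A
  transfer = mk⇔
    (λ (A⊆B , clique) → A⊆B , λ xA yA x≢y → trans (sym (agree (A⊆B xA) (A⊆B yA))) (clique xA yA x≢y))
    (λ (A⊆B , clique) → A⊆B , λ xA yA x≢y → trans (agree (A⊆B xA) (A⊆B yA)) (clique xA yA x≢y))

cliques-union : ∀ (G : Graph n) {X Y U C} → X ⊆ U → Y ⊆ U → X ∩ Y ⊆ C →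
                cliques G X + cliques G Y ≤ cliques G U + cliques G C
cliques-union G {X} {Y} {U} {C} X⊆U Y⊆U X∩Y⊆C = begin
  count PX + count PY
    ≡⟨ count-additive (λ S → sym (⟦∨⟧+⟦∧⟧ (PX S) (PY S))) ⟩
  count (λ S → PX S ∨ PY S) + count (λ S → PY S ∧ PX S)
    ≤⟨ +-mono-≤ (count-mono in-union) (count-mono in-intersection) ⟩
  count PU + count PC
    ∎
  where
  open ≤-Reasoning
  PX PY PU PC : Subset _ → Bool
  PX = cliqueInᵇ G X
  PY = cliqueInᵇ G Y
  PU = cliqueInᵇ G U
  PC = cliqueInᵇ G C
  in-union : ∀ S → PX S ∨ PY S ≡ true → PU S ≡ true
  in-union S h with ∨-true h
  ... | inj₁ hX = cliqueInᵇ-mono G X⊆U S hX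
  ... | inj₂ hY = cliqueInᵇ-mono G Y⊆U S hY
  in-intersection : ∀ S → PY S ∧ PX S ≡ true → PC S ≡ true
  in-intersection S h with Equivalence.to ∧-reflects h
  ... | hY , hX with Equivalence.to (cliqueInᵇ-reflects G X S) hX | Equivalence.to (cliqueInᵇ-reflects G Y S) hY
  ...   | S⊆X , clique | S⊆Y , _ =
    Equivalence.from (cliqueInᵇ-reflects G C S) ((λ xS → X∩Y⊆C (x∈A∩B⁺ (S⊆X xS) (S⊆Y xS))) , clique)

-- Cliques through exactly one of u, v map onto cliques through u in the contraction, two-to-one
-- only on cliques of the common neighbourhood C; cliques through both correspond to cliques of C.
cliques-contract : ∀ (G : Graph n) → u ∈ A → v ∈ A → adj G u v ≡ true →
  cliques G A ≤ cliques (contract G u v) (A - v) + 2 * cliques G (nbrs G (nbrs G A v) u)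
cliques-contract {u = u} {A = A} {v = v} G uA vA uv = begin
  cliques G A
    ≡⟨ cliques-remove G vA ⟩
  cliques G A₁ + cliques G Nv
    ≡⟨ cong₂ _+_ (cliques-remove G uA₁) (cliques-remove G uNv) ⟩
  (cliques G A₂ + cliques G X) + (cliques G Y + cliques G C)
    ≡⟨ regroup (cliques G A₂) (cliques G X) (cliques G Y) (cliques G C) ⟩
  cliques G A₂ + (cliques G X + cliques G Y) + cliques G C
    ≤⟨ +-monoˡ-≤ (cliques G C) (+-monoʳ-≤ (cliques G A₂) (cliques-union G X⊆U Y⊆U X∩Y⊆C)) ⟩
  cliques G A₂ + (cliques G U + cliques G C) + cliques G C
    ≡⟨ regroup′ (cliques G A₂) (cliques G U) (cliques G C) ⟩
  (cliques G A₂ + cliques G U) + 2 * cliques G C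
    ≡⟨ cong (_+ 2 * cliques G C) (cong₂ _+_ (cliques-cong G G′ (contract-agrees G u v u∉A₂))
                                            (cliques-cong G G′ (contract-agrees G u v u∉U))) ⟩
  (cliques G′ A₂ + cliques G′ U) + 2 * cliques G C
    ≡⟨ cong (_+ 2 * cliques G C) (cliques-remove G′ uA₁) ⟨
  cliques G′ A₁ + 2 * cliques G C
    ∎
  where
  open ≤-Reasoning
  G′ : Graph _
  G′ = contract G u v
  A₁ A₂ Nv X Y C U : VertexSet _
  A₁ = A - v
  A₂ = A₁ - u
  Nv = nbrs G A v
  X  = nbrs G A₁ u
  Y  = Nv - u
  C  = nbrs G Nv u
  U  = nbrs G′ A₁ u
  regroup : ∀ a x y c → (a + x) + (y + c) ≡ a + (x + y) + c
  regroup = solve-∀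
  regroup′ : ∀ a w c → a + (w + c) + c ≡ (a + w) + 2 * c
  regroup′ = solve-∀
  uA₁ : u ∈ A₁
  uA₁ = x∈A∧x≢v⇒x∈A-v uA (adj-≢ G uv)
  uNv : u ∈ Nv
  uNv = x∈A∩B⁺ uA (holds (trans (Graph.sym G v u) uv))
  u∉A₂ : ¬ u ∈ A₂
  u∉A₂ h = x∈A-v⇒x≢v A₁ u h refl
  u∉U : ¬ u ∈ U
  u∉U h = adj-≢ {x = u} G′ (truth (A∩B⊆B A₁ (adj G′ u) h)) refl
  merged-nbr : y ≢ u → adj G u y ≡ true ⊎ adj G v y ≡ true → adj G′ u y ≡ true
  merged-nbr {y} y≢u (inj₁ uy) = trans (contract-adj-u G u v y≢u) (cong (_∨ adj G v y) uy)
  merged-nbr {y} y≢u (inj₂ vy) =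
    trans (contract-adj-u G u v y≢u) (trans (cong (adj G u y ∨_) vy) (∨-zeroʳ (adj G u y)))
  X⊆U : X ⊆ U
  X⊆U {x} xX = x∈A∩B⁺ (A∩B⊆A A₁ (adj G u) xX) (holds (merged-nbr (≢-sym (adj-≢ G ux)) (inj₁ ux)))
    where
    ux : adj G u x ≡ true
    ux = truth (A∩B⊆B A₁ (adj G u) xX)
  Y⊆U : Y ⊆ U
  Y⊆U {x} xY = x∈A∩B⁺ (x∈A∧x≢v⇒x∈A-v (A∩B⊆A A (adj G v) xNv) (≢-sym (adj-≢ G vx)))
                      (holds (merged-nbr (x∈A-v⇒x≢v Nv u xY) (inj₂ vx)))
    where
    xNv : x ∈ Nv
    xNv = A-v⊆A Nv u xY
    vx : adj G v x ≡ true
    vx = truth (A∩B⊆B A (adj G v) xNv)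
  X∩Y⊆C : X ∩ Y ⊆ C
  X∩Y⊆C h = x∈A∩B⁺ (A-v⊆A Nv u (A∩B⊆B X Y h)) (A∩B⊆B A₁ (adj G u) (A∩B⊆A X Y h))

-- Minor models

ModelIn : ℕ → Graph n → VertexSet n → Set
ModelIn m G A = Σ (KMinorModel m G) λ M → ∀ {x i} → KMinorModel.branch M x ≡ just i → x ∈ A

model-mono : A ⊆ B → ModelIn m G A → ModelIn m G B
model-mono A⊆B (M , inside) = M , A⊆B ∘ inside

walk-head : ∀ {P : Fin n → Set} → WalkIn G P x y → P x
walk-head (here p)     = p
walk-head (step p _ _) = p

walk-snoc : ∀ {P : Fin n → Set} {z} → WalkIn G P x y → adj G y z ≡ true → P z → WalkIn G P x z
walk-snoc (here p)      yz pz = step p yz (here pz)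
walk-snoc (step p e wk) yz pz = step p e (walk-snoc wk yz pz)

walk-map : ∀ {P : Fin n → Set} {Q : Fin k → Set} (f : Fin k → Fin n) →
           (∀ {i} → Q i → P (f i)) → (∀ {i j} → adj H i j ≡ true → adj G (f i) (f j) ≡ true) →
           ∀ {i j} → WalkIn H Q i j → WalkIn G P (f i) (f j)
walk-map f Q⇒P edge (here q)      = here (Q⇒P q)
walk-map f Q⇒P edge (step q e wk) = step (Q⇒P q) (edge e) (walk-map f Q⇒P edge wk)

-- M′ is pulled back along v ↦ u: v joins the branch set of u, to which it is attached by uv.
model-uncontract : ∀ (G : Graph n) → u ∈ A → v ∈ A → adj G u v ≡ true →
                   ModelIn m (contract G u v) (A - v) → ModelIn m G A
model-uncontract {n = n} {u = u} {A = A} {v = v} {m = m} G uA vA uv (M′ , inside′) = M , inside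
  where
  open KMinorModel M′ renaming (branch to br′; nonempty to nonempty′; connected to connected′; joined to joined′)
  G′ : Graph n
  G′ = contract G u v
  vu : adj G v u ≡ true
  vu = trans (Graph.sym G v u) uv
  σ : Fin n → Fin n
  σ x with x ≟ v
  ... | yes _ = u
  ... | no _  = x
  σ-v : σ v ≡ u
  σ-v with v ≟ v
  ... | yes _   = refl
  ... | no v≢v  = ⊥-elim (v≢v refl)
  σ-≢ : x ≢ v → σ x ≡ x
  σ-≢ {x} x≢v with x ≟ v
  ... | yes x≡v = ⊥-elim (x≢v x≡v)
  ... | no _    = refl
  br : Fin n → Maybe (Fin m)
  br = br′ ∘ σ
  In : Fin m → Fin n → Set
  In i w = br w ≡ just i
  up : ∀ {i} → br′ x ≡ just i → In i x
  up {x} p = trans (cong br′ (σ-≢ (x∈A-v⇒x≢v A v (inside′ p)))) p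
  up-v : ∀ {i} → br′ u ≡ just i → In i v
  up-v p = trans (cong br′ σ-v) p
  lift : ∀ {i} → WalkIn G′ (λ w → br′ w ≡ just i) x y → WalkIn G (In i) x y
  lift (here p) = here (up p)
  lift (step p e wk) with contract-edge G u v e
  ... | inj₁ e₁                  = step (up p) e₁ (lift wk)
  ... | inj₂ (inj₁ (refl , vw))  = step (up p) uv (step (up-v p) vw (lift wk))
  ... | inj₂ (inj₂ (refl , xv))  = step (up p) xv (step (up-v (walk-head wk)) vu (lift wk))
  from-σ : ∀ {i} → In i x → WalkIn G (In i) (σ x) y → WalkIn G (In i) x y
  from-σ {x} {y} {i} px wk with v ≟ x
  ... | yes refl = step px vu (subst (λ z → WalkIn G (In i) z y) σ-v wk)
  ... | no v≢x   = subst (λ z → WalkIn G (In i) z y) (σ-≢ (≢-sym v≢x)) wk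
  to-σ : ∀ {i} → In i y → WalkIn G (In i) x (σ y) → WalkIn G (In i) x y
  to-σ {y} {x} {i} py wk with v ≟ y
  ... | yes refl = walk-snoc (subst (WalkIn G (In i) x) σ-v wk) uv py
  ... | no v≢y   = subst (WalkIn G (In i) x) (σ-≢ (≢-sym v≢y)) wk
  joined : ∀ i j → i ≢ j → Σ (Fin n) λ x → Σ (Fin n) λ y → In i x × In j y × Adj G x y
  joined i j i≢j with joined′ i j i≢j
  ... | x , y , px , py , e with contract-edge G u v e
  ...   | inj₁ e₁                 = x , y , up px , up py , e₁
  ...   | inj₂ (inj₁ (refl , vy)) = v , y , up-v px , up py , vy
  ...   | inj₂ (inj₂ (refl , xv)) = x , v , up px , up-v py , xv
  M : KMinorModel m G
  M = record
    { branch    = br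
    ; nonempty  = λ i → let (x , p) = nonempty′ i in x , up p
    ; connected = λ i x y px py → from-σ px (to-σ py (lift (connected′ i (σ x) (σ y) px py)))
    ; joined    = joined
    }
  inside : ∀ {x i} → br x ≡ just i → x ∈ A
  inside {x} p with v ≟ x
  ... | yes refl = vA
  ... | no v≢x   = A-v⊆A A v (inside′ (trans (sym (cong br′ (σ-≢ (≢-sym v≢x)))) p))

model-embed : ∀ (G : Graph n) {H : Graph k} (f : Fin k → Fin n) → Injective _≡_ _≡_ f →
              (∀ i → f i ∈ A) → (∀ {i j} → adj H i j ≡ true → adj G (f i) (f j) ≡ true) →
              KMinorModel m H → ModelIn m G A
model-embed {n = n} {k = k} {A = A} {m = m} G {H} f f-injective fA edge MH = M , inside
  where
  open KMinorModel MH renaming (branch to brH; nonempty to nonemptyH; connected to connectedH; joined to joinedH)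
  br : Fin n → Maybe (Fin m)
  br x with any? (λ i → f i ≟ x)
  ... | yes (i , _) = brH i
  ... | no _        = nothing
  br-f : ∀ i → br (f i) ≡ brH i
  br-f i with any? (λ j → f j ≟ f i)
  ... | yes (j , fj≡fi) = cong brH (f-injective fj≡fi)
  ... | no none         = ⊥-elim (none (i , refl))
  preimage : ∀ {x c} → br x ≡ just c → Σ (Fin k) λ i → f i ≡ x × brH i ≡ just c
  preimage {x} p with any? (λ i → f i ≟ x)
  ... | yes (i , fi≡x) = i , fi≡x , p
  connected : ∀ c x y → br x ≡ just c → br y ≡ just c → WalkIn G (λ w → br w ≡ just c) x y
  connected c x y px py with preimage px | preimage py
  ... | i , refl , pi | j , refl , pj = walk-map f (λ {l} q → trans (br-f l) q) edge (connectedH c i j pi pj)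
  M : KMinorModel m G
  M = record
    { branch    = br
    ; nonempty  = λ c → let (i , p) = nonemptyH c in f i , trans (br-f i) p
    ; connected = connected
    ; joined    = λ c d c≢d → let (i , j , pi , pj , e) = joinedH c d c≢d in
                    f i , f j , trans (br-f i) pi , trans (br-f j) pj , edge e
    }
  inside : ∀ {x c} → br x ≡ just c → x ∈ A
  inside p with preimage p
  ... | i , refl , _ = fA i

-- Models of K_m whose branch sets are the blocks of blk and are cliques, certified by evaluation.
module BlockModel (H : Graph k) (blk : Fin k → Fin m) where

  surjectiveᵇ : Bool
  surjectiveᵇ = all (λ c → any (λ i → does (blk i ≟ c)) (allFin k)) (allFin m)

  blocksCliquesᵇ : Bool
  blocksCliquesᵇ =
    all (λ i → all (λ j → not (does (blk i ≟ blk j)) ∨ does (i ≟ j) ∨ adj H i j) (allFin k)) (allFin k)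

  joinedByᵇ : Fin m → Fin m → Bool
  joinedByᵇ c d =
    any (λ i → any (λ j → does (blk i ≟ c) ∧ does (blk j ≟ d) ∧ adj H i j) (allFin k)) (allFin k)

  blocksJoinedᵇ : Bool
  blocksJoinedᵇ = all (λ c → all (λ d → does (c ≟ d) ∨ joinedByᵇ c d) (allFin m)) (allFin m)

  isBlockModelᵇ : Bool
  isBlockModelᵇ = surjectiveᵇ ∧ blocksCliquesᵇ ∧ blocksJoinedᵇ

  block-model : isBlockModelᵇ ≡ true → KMinorModel m H
  block-model h = record
    { branch    = just ∘ blk
    ; nonempty  = nonempty′
    ; connected = connected
    ; joined    = joined
    }
    where
    open Equivalence using (to)
    everywhere : ∀ {n} (p : Fin n → Bool) → all p (allFin n) ≡ true → ∀ i → p i ≡ true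
    everywhere p = to (all-allFin-reflects p)
    surjective : surjectiveᵇ ≡ true
    surjective = proj₁ (to (∧-reflects {surjectiveᵇ}) h)
    rest : blocksCliquesᵇ ∧ blocksJoinedᵇ ≡ true
    rest = proj₂ (to (∧-reflects {surjectiveᵇ}) h)
    cliques-ok : blocksCliquesᵇ ≡ true
    cliques-ok = proj₁ (to (∧-reflects {blocksCliquesᵇ}) rest)
    joined-ok : blocksJoinedᵇ ≡ true
    joined-ok = proj₂ (to (∧-reflects {blocksCliquesᵇ}) rest)
    nonempty′ : ∀ c → ∃ λ x → just (blk x) ≡ just c
    nonempty′ c = let (i , e) = any-allFin-witness _ (everywhere _ surjective c) in i , cong just (≟-true e)
    connected : ∀ c x y → just (blk x) ≡ just c → just (blk y) ≡ just c →
                WalkIn H (λ w → just (blk w) ≡ just c) x y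
    connected c x y px py with x ≟ y
    ... | yes refl = here px
    ... | no x≢y   = step px adjacent (here py)
      where
      adjacent : adj H x y ≡ true
      adjacent = to (implies-reflects _ _ _) (everywhere _ (everywhere _ cliques-ok x) y)
                    (dec-true (blk x ≟ blk y) (just-injective (trans px (sym py)))) (dec-false (x ≟ y) x≢y)
    joined : ∀ c d → c ≢ d →
             Σ (Fin k) λ x → Σ (Fin k) λ y → just (blk x) ≡ just c × just (blk y) ≡ just d × Adj H x y
    joined c d c≢d =
      let joined-cd = trans (cong (_∨ joinedByᵇ c d) (sym (dec-false (c ≟ d) c≢d)))
                            (everywhere _ (everywhere _ joined-ok c) d)
          (i , hi)  = any-allFin-witness _ joined-cd
          (j , hij) = any-allFin-witness _ hi
          (ic , jd-adj) = to (∧-reflects {does (blk i ≟ c)}) hij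
          (jd , adj-ij) = to (∧-reflects {does (blk j ≟ d)}) jd-adj
      in i , j , cong just (≟-true ic) , cong just (≟-true jd) , adj-ij

-- Small graphs and the local K₅

-- A graph on Fin (suc k) is coded by the neighbours of zero followed by the code of the rest,
-- so that allCodes k lists every graph on Fin k exactly once.
Code : ℕ → Set
Code zero    = ⊤
Code (suc k) = Subset k × Code k

codeAdj : Code k → Fin k → Fin k → Bool
codeAdj (r , c) zero    zero    = false
codeAdj (r , c) zero    (suc j) = lookup r j
codeAdj (r , c) (suc i) zero    = lookup r i
codeAdj (r , c) (suc i) (suc j) = codeAdj c i j

codeGraph : Code k → Graph k
codeGraph c = record { adj = codeAdj c ; sym = codeAdj-sym c ; irrefl = codeAdj-irrefl c }
  where
  codeAdj-sym : ∀ (c : Code k) i j → codeAdj c i j ≡ codeAdj c j i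
  codeAdj-sym c       zero    zero    = refl
  codeAdj-sym c       zero    (suc j) = refl
  codeAdj-sym c       (suc i) zero    = refl
  codeAdj-sym (r , c) (suc i) (suc j) = codeAdj-sym c i j
  codeAdj-irrefl : ∀ (c : Code k) i → codeAdj c i i ≡ false
  codeAdj-irrefl c       zero    = refl
  codeAdj-irrefl (r , c) (suc i) = codeAdj-irrefl c i

codeOf : (Fin k → Fin k → Bool) → Code k
codeOf {zero}  g = tt
codeOf {suc k} g = tabulate (g zero ∘ suc) , codeOf (λ i j → g (suc i) (suc j))

codeAdj-codeOf : ∀ (g : Fin k → Fin k → Bool) → (∀ i j → g i j ≡ g j i) →
                 (∀ i → g i i ≡ false) → ∀ i j → codeAdj (codeOf g) i j ≡ g i j
codeAdj-codeOf g g-sym g-irrefl zero    zero    = sym (g-irrefl zero)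
codeAdj-codeOf g g-sym g-irrefl zero    (suc j) = lookup∘tabulate (g zero ∘ suc) j
codeAdj-codeOf g g-sym g-irrefl (suc i) zero    =
  trans (lookup∘tabulate (g zero ∘ suc) i) (g-sym zero (suc i))
codeAdj-codeOf g g-sym g-irrefl (suc i) (suc j) =
  codeAdj-codeOf (λ i j → g (suc i) (suc j)) (λ i j → g-sym (suc i) (suc j)) (g-irrefl ∘ suc) i j

allCodes : (k : ℕ) → List (Code k)
allCodes zero    = tt ∷ []
allCodes (suc k) = cartesianProduct (allSubsets k) (allCodes k)

∈-allSubsets : ∀ (S : Subset n) → S List.∈ allSubsets n
∈-allSubsets []          = here refl
∈-allSubsets (true ∷ S)  = ∈-++⁺ˡ (∈-map⁺ (true ∷_) (∈-allSubsets S))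
∈-allSubsets {suc n} (false ∷ S) =
  ∈-++⁺ʳ (map (true ∷_) (allSubsets n)) (∈-map⁺ (false ∷_) (∈-allSubsets S))

∈-allCodes : ∀ (c : Code k) → c List.∈ allCodes k
∈-allCodes {zero}  tt      = here refl
∈-allCodes {suc k} (r , c) = ∈-cartesianProduct⁺ (∈-allSubsets r) (∈-allCodes c)

all-allCodes : ∀ (p : Code k → Bool) → all p (allCodes k) ≡ true → ∀ c → p c ≡ true
all-allCodes {k} p h c =
  Equivalence.to T-≡ (All.lookup (all⁺ p (allCodes k) (Equivalence.from T-≡ h)) (∈-allCodes c))

apex : Code k → Code (suc k)
apex {k} c = replicate k true , c

minDegree≥3ᵇ : Code k → Bool
minDegree≥3ᵇ {k} c = all (λ i → 3 ≤ᵇ sum (λ j → ⟦ codeAdj c i j ⟧)) (allFin k)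

isApexBlockModelᵇ : Code k → Vec (Fin 5) (suc k) → Bool
isApexBlockModelᵇ c b = BlockModel.isBlockModelᵇ (codeGraph (apex c)) (lookup b)

apexK5Checkᵇ : ∀ k → List (Vec (Fin 5) (suc k)) → Bool
apexK5Checkᵇ k blockings =
  all (λ c → not (minDegree≥3ᵇ c) ∨ any (isApexBlockModelᵇ c) blockings) (allCodes k)

apexK5Check-sound : ∀ blockings → apexK5Checkᵇ k blockings ≡ true →
                    ∀ c → minDegree≥3ᵇ c ≡ true → KMinorModel 5 (codeGraph (apex c))
apexK5Check-sound {k} blockings check c minDegree =
  BlockModel.block-model (codeGraph (apex c)) (lookup b) (Equivalence.to T-≡ isModel)
  where
  some : any (isApexBlockModelᵇ c) blockings ≡ true
  some = trans (cong (λ t → not t ∨ any (isApexBlockModelᵇ c) blockings) (sym minDegree))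
               (all-allCodes (λ c → not (minDegree≥3ᵇ c) ∨ any (isApexBlockModelᵇ c) blockings) check c)
  b : Vec (Fin 5) (suc k)
  b = proj₁ (satisfied (any⁻ (isApexBlockModelᵇ c) blockings (Equivalence.from T-≡ some)))
  isModel : T (isApexBlockModelᵇ c b)
  isModel = proj₂ (satisfied (any⁻ (isApexBlockModelᵇ c) blockings (Equivalence.from T-≡ some)))

blockings₄ : List (Vec (Fin 5) 5)
blockings₄ = (0F ∷ 1F ∷ 2F ∷ 3F ∷ 4F ∷ []) ∷ []

-- The apex is a branch set on its own; for five neighbours, two of them share a branch set.
blockings₅ : List (Vec (Fin 5) 6)
blockings₅ =
    (0F ∷ 1F ∷ 1F ∷ 2F ∷ 3F ∷ 4F ∷ []) ∷ (0F ∷ 1F ∷ 2F ∷ 1F ∷ 3F ∷ 4F ∷ [])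
  ∷ (0F ∷ 1F ∷ 2F ∷ 3F ∷ 1F ∷ 4F ∷ []) ∷ (0F ∷ 1F ∷ 2F ∷ 3F ∷ 4F ∷ 1F ∷ [])
  ∷ (0F ∷ 2F ∷ 1F ∷ 1F ∷ 3F ∷ 4F ∷ []) ∷ (0F ∷ 2F ∷ 1F ∷ 3F ∷ 1F ∷ 4F ∷ [])
  ∷ (0F ∷ 2F ∷ 1F ∷ 3F ∷ 4F ∷ 1F ∷ []) ∷ (0F ∷ 2F ∷ 3F ∷ 1F ∷ 1F ∷ 4F ∷ [])
  ∷ (0F ∷ 2F ∷ 3F ∷ 1F ∷ 4F ∷ 1F ∷ []) ∷ (0F ∷ 2F ∷ 3F ∷ 4F ∷ 1F ∷ 1F ∷ []) ∷ []

apexK5-4 : apexK5Checkᵇ 4 blockings₄ ≡ true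
apexK5-4 = refl

apexK5-5 : apexK5Checkᵇ 5 blockings₅ ≡ true
apexK5-5 = refl

apex-model : ∀ blockings → apexK5Checkᵇ k blockings ≡ true →
             ∀ (G : Graph n) → x ∈ A → deg G A x ≡ k →
             (∀ {w} → w ∈ nbrs G A x → 3 ≤ deg G (nbrs G A x) w) → ModelIn 5 G A
apex-model {k} {n} {x} {A} blockings check G xA deg≡k dense =
  model-embed G φ φ-injective φA (λ {i} {j} → edge i j) (apexK5Check-sound blockings check c minDegree)
  where
  N : VertexSet n
  N = nbrs G A x
  open Enumeration (enumerate N deg≡k)
  φ : Fin (suc k) → Fin n
  φ zero    = x
  φ (suc i) = elt i
  c : Code k
  c = codeOf (λ i j → adj G (elt i) (elt j))
  codeAdj-c : ∀ i j → codeAdj c i j ≡ adj G (elt i) (elt j)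
  codeAdj-c = codeAdj-codeOf (λ i j → adj G (elt i) (elt j))
                             (λ i j → Graph.sym G (elt i) (elt j)) (λ i → irrefl G (elt i))
  x-adj : ∀ i → adj G x (elt i) ≡ true
  x-adj i = truth (A∩B⊆B A (adj G x) (member i))
  edge-exact : ∀ i j → adj (codeGraph (apex c)) i j ≡ adj G (φ i) (φ j)
  edge-exact zero    zero    = sym (irrefl G x)
  edge-exact zero    (suc j) = trans (lookup-replicate j true) (sym (x-adj j))
  edge-exact (suc i) zero    = trans (lookup-replicate i true) (sym (trans (Graph.sym G (elt i) x) (x-adj i)))
  edge-exact (suc i) (suc j) = codeAdj-c i j
  edge : ∀ i j → adj (codeGraph (apex c)) i j ≡ true → adj G (φ i) (φ j) ≡ true
  edge i j e = trans (sym (edge-exact i j)) e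
  φ-injective : Injective _≡_ _≡_ φ
  φ-injective {zero}  {zero}  _   = refl
  φ-injective {zero}  {suc j} x≡  = ⊥-elim (adj-≢ G (x-adj j) x≡)
  φ-injective {suc i} {zero}  ≡x  = ⊥-elim (adj-≢ G (x-adj i) (sym ≡x))
  φ-injective {suc i} {suc j} e   = cong suc (injective e)
  φA : ∀ i → φ i ∈ A
  φA zero    = xA
  φA (suc i) = A∩B⊆A A (adj G x) (member i)
  degree : ∀ i → deg G N (elt i) ≡ sum (λ j → ⟦ codeAdj c i j ⟧)
  degree i = begin
    deg G N (elt i)                          ≡⟨ ∑∈-∩ N (adj G (elt i)) ⟩
    ∑∈ N (λ y → ⟦ adj G (elt i) y ⟧)         ≡⟨ ∑∈-elt (λ y → ⟦ adj G (elt i) y ⟧) ⟩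
    sum (λ j → ⟦ adj G (elt i) (elt j) ⟧)    ≡⟨ sum-cong-≗ (λ j → cong ⟦_⟧ (codeAdj-c i j)) ⟨
    sum (λ j → ⟦ codeAdj c i j ⟧)            ∎
    where open ≡-Reasoning
  minDegree : minDegree≥3ᵇ c ≡ true
  minDegree = Equivalence.from (all-allFin-reflects _) λ i →
    Equivalence.to T-≡ (≤⇒≤ᵇ (≤-trans (dense (member i)) (≤-reflexive (degree i))))

four-or-five : ∀ {d} → 4 ≤ d → d ≤ 5 → d ≡ 4 ⊎ d ≡ 5
four-or-five 4≤d d≤5 with m≤n⇒m<n∨m≡n 4≤d
... | inj₁ 4<d = inj₂ (≤-antisym d≤5 4<d)
... | inj₂ 4≡d = inj₁ (sym 4≡d)

local-K5 : ∀ (G : Graph n) → x ∈ A → 4 ≤ deg G A x → deg G A x ≤ 5 →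
           (∀ {w} → w ∈ nbrs G A x → 3 ≤ deg G (nbrs G A x) w) → ModelIn 5 G A
local-K5 G xA 4≤deg deg≤5 dense with four-or-five 4≤deg deg≤5
... | inj₁ deg≡4 = apex-model blockings₄ apexK5-4 G xA deg≡4 dense
... | inj₂ deg≡5 = apex-model blockings₅ apexK5-5 G xA deg≡5 dense

-- The induction

-- (|A| − 2) δ ≤ degreeSum G (A - x) ≤ 6 (|A| − 3), so δ < 6.
min-degree≤5 : ∀ (G : Graph n) {j} → size A ≡ 4 + j → x ∈ A →
               (∀ {y} → y ∈ A → deg G A x ≤ deg G A y) → degreeSum G (A - x) ≤ 6 * suc j → deg G A x ≤ 5
min-degree≤5 {A = A} {x = x} G {j} size≡ xA minimal sum-bound = counting (begin
  (4 + j) * δ                                ≡⟨ cong (_* δ) size≡ ⟨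
  size A * δ                                 ≤⟨ degreeSum-≥ G δ minimal ⟩
  degreeSum G A                              ≡⟨ degreeSum-remove G xA ⟩
  degreeSum G (A - x) + 2 * deg G (A - x) x  ≡⟨ cong ((degreeSum G (A - x) +_) ∘ (2 *_)) (deg-remove-self G xA) ⟨
  degreeSum G (A - x) + 2 * δ                ≤⟨ +-monoˡ-≤ (2 * δ) sum-bound ⟩
  6 * suc j + 2 * δ                          ∎)
  where
  open ≤-Reasoning
  δ : ℕ
  δ = deg G A x
  counting : (4 + j) * δ ≤ 6 * suc j + 2 * δ → δ ≤ 5
  counting h with δ ≤? 5
  ... | yes δ≤5 = δ≤5
  ... | no δ≰5  = ⊥-elim (<-irrefl refl (begin-strict
    6 * suc j        <⟨ m<m+n (6 * suc j) {6} (s≤s z≤n) ⟩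
    6 * suc j + 6    ≡⟨ regroup j ⟩
    (2 + j) * 6      ≤⟨ *-monoʳ-≤ (2 + j) (≰⇒> δ≰5) ⟩
    (2 + j) * δ      ≤⟨ +-cancelʳ-≤ (2 * δ) _ _ (≤-trans (≤-reflexive (split j δ)) h) ⟩
    6 * suc j        ∎))
    where
    regroup : ∀ j → 6 * suc j + 6 ≡ (2 + j) * 6
    regroup = solve-∀
    split : ∀ j d → (2 + j) * d + 2 * d ≡ (4 + j) * d
    split = solve-∀

low-degree-or-thin-edge : ∀ (G : Graph n) → ¬ ModelIn 5 G A → x ∈ A → deg G A x ≤ 5 →
                          deg G A x ≤ 3 ⊎ ∃[ w ] (w ∈ nbrs G A x × deg G (nbrs G A x) w ≤ 2)
low-degree-or-thin-edge {A = A} {x = x} G noK5 xA δ≤5 with deg G A x ≤? 3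
... | yes δ≤3 = inj₁ δ≤3
... | no δ≰3 with any? (λ w → (nbrs G A x w ≟ᵇ true) ×-dec (deg G (nbrs G A x) w ≤? 2))
...   | yes (w , wN , thin) = inj₂ (w , holds wN , thin)
...   | no none = ⊥-elim (noK5 (local-K5 G xA (≰⇒> δ≰3) δ≤5 dense))
  where
  dense : ∀ {w} → w ∈ nbrs G A x → 3 ≤ deg G (nbrs G A x) w
  dense {w} wN = ≰⇒> (λ thin → none (w , truth wN , thin))

step-bound : ∀ c j {a b} → a ≤ c * suc j → b ≤ c → a + b ≤ c * suc (suc j)
step-bound c j a≤ b≤ =
  ≤-trans (+-mono-≤ a≤ b≤) (≤-reflexive (trans (+-comm (c * suc j) c) (sym (*-suc c (suc j)))))

-- For |A| = 3 + j: e(G[A]) ≤ 3|A| − 6 and c(G[A]) ≤ 8(|A| − 2).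
Bounds : ℕ → Graph n → VertexSet n → Set
Bounds j G A = degreeSum G A ≤ 6 * suc j × cliques G A ≤ 8 * suc j

bounds-delete : ∀ (G : Graph n) {j} → x ∈ A → deg G A x ≤ 3 → Bounds j G (A - x) → Bounds (suc j) G A
bounds-delete {x = x} {A = A} G {j} xA δ≤3 (sum-bound , cliques-bound) =
  ≤-trans (≤-reflexive (degreeSum-remove G xA)) (step-bound 6 j sum-bound (*-monoʳ-≤ 2 deg≤3)) ,
  ≤-trans (≤-reflexive (cliques-remove G xA)) (step-bound 8 j cliques-bound cliques≤8)
  where
  deg≤3 : deg G (A - x) x ≤ 3
  deg≤3 = ≤-trans (≤-reflexive (sym (deg-remove-self G xA))) δ≤3
  cliques≤8 : cliques G (nbrs G A x) ≤ 8
  cliques≤8 = ≤-trans (cliques≤2^size G (nbrs G A x)) (^-monoʳ-≤ 2 δ≤3)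

bounds-contract : ∀ (G : Graph n) {j} → w ∈ A → x ∈ A → adj G w x ≡ true →
                  size (nbrs G (nbrs G A x) w) ≤ 2 → Bounds j (contract G w x) (A - x) → Bounds (suc j) G A
bounds-contract {w = w} {A = A} {x = x} G {j} wA xA wx thin (sum-bound , cliques-bound) =
  ≤-trans (≤-reflexive (degreeSum-contract G wA xA wx)) (step-bound 6 j sum-bound (*-monoʳ-≤ 2 (s≤s thin))) ,
  ≤-trans (cliques-contract G wA xA wx) (step-bound 8 j cliques-bound (*-monoʳ-≤ 2 cliques≤4))
  where
  cliques≤4 : cliques G (nbrs G (nbrs G A x) w) ≤ 4
  cliques≤4 = ≤-trans (cliques≤2^size G (nbrs G (nbrs G A x) w)) (^-monoʳ-≤ 2 thin)

bounds-step : ∀ {j} → (∀ {n} (G : Graph n) A → size A ≡ 3 + j → ¬ ModelIn 5 G A → Bounds j G A) →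
              ∀ (G : Graph n) A → size A ≡ 4 + j → ¬ ModelIn 5 G A → Bounds (suc j) G A
bounds-step {j = j} IH G A size≡ noK5 with minimiser {A = A} (deg G A) (proj₂ (nonempty {A = A} size≡))
... | x , xA , minimal =
  by-cases (low-degree-or-thin-edge G noK5 xA (min-degree≤5 G size≡ xA minimal (proj₁ IH-delete)))
  where
  size-x : size (A - x) ≡ 3 + j
  size-x = suc-injective (trans (sym (size-remove xA)) size≡)
  IH-delete : Bounds j G (A - x)
  IH-delete = IH G (A - x) size-x (noK5 ∘ model-mono (A-v⊆A A x))
  by-cases : deg G A x ≤ 3 ⊎ ∃[ w ] (w ∈ nbrs G A x × deg G (nbrs G A x) w ≤ 2) → Bounds (suc j) G A
  by-cases (inj₁ δ≤3) = bounds-delete G xA δ≤3 IH-delete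
  by-cases (inj₂ (w , wN , thin)) =
    bounds-contract G wA xA wx thin (IH (contract G w x) (A - x) size-x (noK5 ∘ model-uncontract G wA xA wx))
    where
    wA : w ∈ A
    wA = A∩B⊆A A (adj G x) wN
    wx : adj G w x ≡ true
    wx = trans (Graph.sym G w x) (truth (A∩B⊆B A (adj G x) wN))

bounds : ∀ j (G : Graph n) A → size A ≡ 3 + j → ¬ ModelIn 5 G A → Bounds j G A
bounds zero G A size≡3 _ =
  ≤-trans (degreeSum-≤ G 2 deg≤2) (≤-reflexive (cong (_* 2) size≡3)) ,
  ≤-trans (cliques≤2^size G A) (≤-reflexive (cong (2 ^_) size≡3))
  where
  deg≤2 : ∀ {x} → x ∈ A → deg G A x ≤ 2
  deg≤2 xA = ≤-pred (≤-trans (deg<size G xA) (≤-reflexive size≡3))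
bounds (suc j) = bounds-step (bounds j)

size-full : ∀ n → size {n} (λ _ → true) ≡ n
size-full zero    = refl
size-full (suc n) = cong suc (size-full n)

theorem6 : (n : ℕ) → 3 ≤ n → (G : Graph n) → ¬ HasKMinor 5 G →
    numCliques G ≤ 8 * (n ∸ 2)
theorem6 (suc (suc (suc j))) (s≤s (s≤s (s≤s z≤n))) G noK5 = begin
  numCliques G            ≡⟨ numCliques≡cliques G ⟩
  cliques G (λ _ → true)  ≤⟨ proj₂ (bounds j G (λ _ → true) (size-full (3 + j)) (noK5 ∘ proj₁)) ⟩
  8 * suc j               ∎
  where open ≤-Reasoning
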